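{- Let $\mathrm{Mon}(\mathbf{Set})$ be the category of monads on $\mathbf{Set}$ and $\mathrm{RMon}(\Delta)$ the category of relative monads on $\Delta:\mathbf{Set}\to\mathbf{Pre}$ (definitions in context). The assignments $\Delta_*$ and $U_*$ described in the context are functors $\Delta_*:\mathrm{Mon}(\mathbf{Set})\to\mathrm{RMon}(\Delta)$ and $U_*:\mathrm{RMon}(\Delta)\to\mathrm{Mon}(\mathbf{Set})$, and $\Delta_*$ is left adjoint to $U_*$.
   Context: $\mathbf{Pre}$ is the category of preordered sets and monotone maps; $\Delta:\mathbf{Set}\to\mathbf{Pre}$ sends a set $X$ to $(X,=)$ (the discrete preorder) and $U:\mathbf{Pre}\to\mathbf{Set}$ is the forgetful functor; monotone maps $\Delta X\to A$ are exactly the maps $X\to UA$, and we write $\varphi$ for this bijection. A monad on $\mathbf{Set}$ (Kleisli form) is $(P,\eta,\sigma)$: sets $PX$, maps $\eta_X:X\to PX$, and for each $f:X\to PY$ a map $\sigma(f):PX\to PY$, with $\sigma(f)\circ\eta_X=f$, $\sigma(\eta_X)=\mathrm{id}$, $\sigma(g)\circ\sigma(f)=\sigma(\sigma(g)\circ f)$. A morphism of monads $\tau:P\to Q$ is a family of maps $\tau_X:PX\to QX$ with $\tau_Y\circ\sigma^P(f)=\sigma^Q(\tau_Y\circ f)\circ\tau_X$ and $\tau_X\circ\eta^P_X=\eta^Q_X$. A relative monad on $\Delta$ is $(R,\eta,\sigma)$: preordered sets $RX$, monotone maps $\eta_X:\Delta X\to RX$, and for each monotone $f:\Delta X\to RY$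 a monotone $\sigma(f):RX\to RY$, with the same three laws; a morphism $\tau:R\to Q$ of relative monads on $\Delta$ is a family of monotone maps $\tau_X:RX\to QX$ satisfying the same two laws. $\Delta_*$ sends a monad $P$ on $\mathbf{Set}$ to $X\mapsto \Delta(PX)$ with unit $\Delta\eta_X$ and substitution $f\mapsto \varphi^{ -1}\bigl(\sigma^P(Uf)\bigr)$ (i.e. $\sigma^P(Uf)$ regarded as a monotone map between discrete preorders), and a monad morphism $\tau$ to $(\Delta\tau_X)_X$. $U_*$ sends a relative monad $R$ on $\Delta$ to $X\mapsto U(RX)$ with unit $U\eta_X$ and substitution $m\mapsto U\bigl(\sigma^R(\varphi^{ -1}m)\bigr)$ for $m:X\to URY$, and a morphism $\tau$ to $(U\tau_X)_X$. -}

module Defs where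

open import Relation.Binary.PropositionalEquality using (_≡_; refl; cong; subst; trans)

record Preord : Set₁ where
  field
    Carrier : Set
    _≤_     : Carrier → Carrier → Set
    refl≤   : ∀ {x} → x ≤ x
    trans≤  : ∀ {x y z} → x ≤ y → y ≤ z → x ≤ z

open Preord public

-- Monotone maps.  The monotonicity proof is irrelevant, so two monotone
-- maps with the same underlying function are the same map (as in Pre).
record Mono (A B : Preord) : Set where
  constructor mono
  field
    fun       : Carrier A → Carrier B
    .monotone : ∀ {x y} → _≤_ A x y → _≤_ B (fun x) (fun y)

open Mono public

idMono : ∀ {A} → Mono A A
idMono {A} = mono (λ x → x) (λ p → p)

_∘M_ : ∀ {A B C} → Mono B C → Mono A B → Mono A C
mono g mg ∘M mono f mf = mono (λ x → g (f x)) (λ p → mg (mf p))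

_≐_ : ∀ {A B : Set} → (A → B) → (A → B) → Set
f ≐ g = ∀ x → f x ≡ g x

_≐M_ : ∀ {A B} → Mono A B → Mono A B → Set
f ≐M g = fun f ≐ fun g

Δ : Set → Preord
Δ X = record { Carrier = X ; _≤_ = _≡_ ; refl≤ = refl ; trans≤ = trans }

U : Preord → Set
U A = Carrier A

φ : ∀ {X A} → Mono (Δ X) A → X → U A
φ f = fun f

φ⁻¹ : ∀ {X A} → (X → U A) → Mono (Δ X) A
φ⁻¹ {X} {A} m = mono m (λ {x} p → subst (λ z → _≤_ A (m x) (m z)) p (refl≤ A))

record MonadData : Set₁ where
  field
    P : Set → Set
    η : ∀ {X} → X → P X
    σ : ∀ {X Y} → (X → P Y) → P X → P Y

record IsMonad (M : MonadData) : Set₁ where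
  open MonadData M
  field
    σ-η  : ∀ {X Y} (f : X → P Y) → (λ x → σ f (η x)) ≐ f
    σ-id : ∀ {X} → σ (η {X}) ≐ (λ x → x)
    σ-σ  : ∀ {X Y Z} (f : X → P Y) (g : Y → P Z) →
           (λ x → σ g (σ f x)) ≐ σ (λ y → σ g (f y))

record Monad : Set₁ where
  field
    dat  : MonadData
    laws : IsMonad dat

record IsMonadHom (M N : MonadData) (τ : ∀ {X} → MonadData.P M X → MonadData.P N X) : Set₁ where
  private
    module M = MonadData M
    module N = MonadData N
  field
    τ-σ : ∀ {X Y} (f : X → M.P Y) →
          (λ x → τ (M.σ f x)) ≐ (λ x → N.σ (λ y → τ (f y)) (τ x))
    τ-η : ∀ {X} → (λ (x : X) → τ (M.η x)) ≐ N.η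

record MonadHom (M N : MonadData) : Set₁ where
  field
    τ     : ∀ {X} → MonadData.P M X → MonadData.P N X
    isHom : IsMonadHom M N τ

record RelMonadData : Set₁ where
  field
    R : Set → Preord
    η : ∀ {X} → Mono (Δ X) (R X)
    σ : ∀ {X Y} → Mono (Δ X) (R Y) → Mono (R X) (R Y)

record IsRelMonad (M : RelMonadData) : Set₁ where
  open RelMonadData M
  field
    σ-η  : ∀ {X Y} (f : Mono (Δ X) (R Y)) → (σ f ∘M η) ≐M f
    σ-id : ∀ {X} → σ (η {X}) ≐M idMono
    σ-σ  : ∀ {X Y Z} (f : Mono (Δ X) (R Y)) (g : Mono (Δ Y) (R Z)) →
           (σ g ∘M σ f) ≐M σ (σ g ∘M f)

record RelMonad : Set₁ where
  field
    dat  : RelMonadData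
    laws : IsRelMonad dat

record IsRelMonadHom (M N : RelMonadData)
    (τ : ∀ {X} → Mono (RelMonadData.R M X) (RelMonadData.R N X)) : Set₁ where
  private
    module M = RelMonadData M
    module N = RelMonadData N
  field
    τ-σ : ∀ {X Y} (f : Mono (Δ X) (M.R Y)) →
          (τ ∘M M.σ f) ≐M (N.σ (τ ∘M f) ∘M τ)
    τ-η : ∀ {X} → (τ ∘M M.η {X}) ≐M N.η

record RelMonadHom (M N : RelMonadData) : Set₁ where
  field
    τ     : ∀ {X} → Mono (RelMonadData.R M X) (RelMonadData.R N X)
    isHom : IsRelMonadHom M N τ

Δ*₀ : MonadData → RelMonadData
Δ*₀ M = record
  { R = λ X → Δ (P X)
  ; η = mono η (cong η)
  ; σ = λ f → mono (σ (fun f)) (cong (σ (fun f)))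
  }
  where open MonadData M

Δ*₁ : ∀ {M N : MonadData} → (∀ {X} → MonadData.P M X → MonadData.P N X) →
      ∀ {X} → Mono (RelMonadData.R (Δ*₀ M) X) (RelMonadData.R (Δ*₀ N) X)
Δ*₁ τ = mono τ (cong τ)

U*₀ : RelMonadData → MonadData
U*₀ M = record
  { P = λ X → U (R X)
  ; η = fun η
  ; σ = λ m → fun (σ (φ⁻¹ m))
  }
  where open RelMonadData M

U*₁ : ∀ {M N : RelMonadData} → (∀ {X} → Mono (RelMonadData.R M X) (RelMonadData.R N X)) →
      ∀ {X} → MonadData.P (U*₀ M) X → MonadData.P (U*₀ N) X
U*₁ τ = fun τ

Δ*-functor : Set₁
Δ*-functor =
  ((P : Monad) → IsRelMonad (Δ*₀ (Monad.dat P)))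
  × ((P Q : Monad) (t : MonadHom (Monad.dat P) (Monad.dat Q)) →
       IsRelMonadHom (Δ*₀ (Monad.dat P)) (Δ*₀ (Monad.dat Q)) (λ {X} → Δ*₁ {Monad.dat P} {Monad.dat Q} (MonadHom.τ t) {X}))
  × ((P : Monad) → ∀ {X} →
       Δ*₁ {Monad.dat P} {Monad.dat P} (λ x → x) {X} ≐M idMono)
  × ((P Q S : Monad) (t : MonadHom (Monad.dat P) (Monad.dat Q))
     (s : MonadHom (Monad.dat Q) (Monad.dat S)) → ∀ {X} →
       Δ*₁ {Monad.dat P} {Monad.dat S} (λ x → MonadHom.τ s (MonadHom.τ t x)) {X}
         ≐M (Δ*₁ {Monad.dat Q} {Monad.dat S} (MonadHom.τ s)
              ∘M Δ*₁ {Monad.dat P} {Monad.dat Q} (MonadHom.τ t)))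
  where open import Data.Product using (_×_)

U*-functor : Set₁
U*-functor =
  ((R : RelMonad) → IsMonad (U*₀ (RelMonad.dat R)))
  × ((R Q : RelMonad) (t : RelMonadHom (RelMonad.dat R) (RelMonad.dat Q)) →
       IsMonadHom (U*₀ (RelMonad.dat R)) (U*₀ (RelMonad.dat Q)) (λ {X} → U*₁ {RelMonad.dat R} {RelMonad.dat Q} (RelMonadHom.τ t) {X}))
  × ((R : RelMonad) → ∀ {X} →
       U*₁ {RelMonad.dat R} {RelMonad.dat R} idMono {X} ≐ (λ x → x))
  × ((R Q S : RelMonad) (t : RelMonadHom (RelMonad.dat R) (RelMonad.dat Q))
     (s : RelMonadHom (RelMonad.dat Q) (RelMonad.dat S)) → ∀ {X} →
       U*₁ {RelMonad.dat R} {RelMonad.dat S} (RelMonadHom.τ s ∘M RelMonadHom.τ t) {X}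
         ≐ (λ x → U*₁ {RelMonad.dat Q} {RelMonad.dat S} (RelMonadHom.τ s)
                    (U*₁ {RelMonad.dat R} {RelMonad.dat Q} (RelMonadHom.τ t) x)))
  where open import Data.Product using (_×_)

-- Δ_* ⊣ U_*: a bijection
--   RMon(Δ)(Δ_* P, R) ≅ Mon(Set)(P, U_* R)
-- natural in P and R (morphisms are compared componentwise, pointwise).
Δ*⊣U* : Set₁
Δ*⊣U* =
  Σ ((P : Monad) (R : RelMonad) →
       RelMonadHom (Δ*₀ (Monad.dat P)) (RelMonad.dat R) →
       MonadHom (Monad.dat P) (U*₀ (RelMonad.dat R))) λ Φ →
  Σ ((P : Monad) (R : RelMonad) →
       MonadHom (Monad.dat P) (U*₀ (RelMonad.dat R)) →
       RelMonadHom (Δ*₀ (Monad.dat P)) (RelMonad.dat R)) λ Ψ →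
    ((P : Monad) (R : RelMonad) (t : RelMonadHom (Δ*₀ (Monad.dat P)) (RelMonad.dat R)) →
       ∀ {X} → RelMonadHom.τ (Ψ P R (Φ P R t)) {X} ≐M RelMonadHom.τ t {X})
  × ((P : Monad) (R : RelMonad) (m : MonadHom (Monad.dat P) (U*₀ (RelMonad.dat R))) →
       ∀ {X} → MonadHom.τ (Φ P R (Ψ P R m)) {X} ≐ MonadHom.τ m {X})
    -- naturality: for α : P' → P, β : R → R', t : Δ_* P → R, and t' the
    -- composite β ∘ t ∘ Δ_* α (given as any morphism with those components),
    -- Φ t' = U_* β ∘ Φ t ∘ α
  × ((P' P : Monad) (R R' : RelMonad)
     (α : MonadHom (Monad.dat P') (Monad.dat P))
     (β : RelMonadHom (RelMonad.dat R) (RelMonad.dat R'))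
     (t : RelMonadHom (Δ*₀ (Monad.dat P)) (RelMonad.dat R))
     (t' : RelMonadHom (Δ*₀ (Monad.dat P')) (RelMonad.dat R')) →
     (∀ {X} → RelMonadHom.τ t' {X}
                ≐M (RelMonadHom.τ β ∘M (RelMonadHom.τ t
                      ∘M Δ*₁ {Monad.dat P'} {Monad.dat P} (MonadHom.τ α)))) →
     ∀ {X} → MonadHom.τ (Φ P' R' t') {X}
               ≐ (λ x → U*₁ {RelMonad.dat R} {RelMonad.dat R'} (RelMonadHom.τ β)
                          (MonadHom.τ (Φ P R t) (MonadHom.τ α x))))
  where open import Data.Product using (Σ; _×_)

module Submission where

-- Everything rests on one observation: φ, sending a monotone map Δ X → A to
-- its underlying function X → U A, is a bijection whose two round trips are
-- the identity on the nose (monotonicity proofs are irrelevant).  Hence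
--   * the underlying function of the substitution of Δ_* P is σ^P, so every
--     law for Δ_* P (or for Δ_* τ) is literally the corresponding law for P
--     (or τ) applied to underlying functions;
--   * the substitution of U_* R is σ^R ∘ φ⁻¹, so every law for U_* R (or for
--     U_* τ) is the corresponding law for R (or τ) applied at φ⁻¹ m;
--   * a morphism Δ_* P → R and a morphism P → U_* R have the same components
--     up to φ, and their morphism laws coincide; transposing along φ gives
--     the adjunction bijection, and naturality holds componentwise.

open import Defs
open import Data.Product using (_×_; _,_)
open import Relation.Binary.PropositionalEquality using (refl)

φ-φ⁻¹ : ∀ {X A} (m : X → U A) → φ {X} {A} (φ⁻¹ m) ≐ m
φ-φ⁻¹ m x = refl

φ⁻¹-φ : ∀ {X A} (f : Mono (Δ X) A) → φ⁻¹ (φ f) ≐M f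
φ⁻¹-φ f x = refl

Δ*-isRelMonad : (M : MonadData) → IsMonad M → IsRelMonad (Δ*₀ M)
Δ*-isRelMonad M laws = record
  { σ-η  = λ f → σ-η (φ f)
  ; σ-id = σ-id
  ; σ-σ  = λ f g → σ-σ (φ f) (φ g)
  }
  where open IsMonad laws

Δ*-isRelMonadHom : (M N : MonadData) {τ : ∀ {X} → MonadData.P M X → MonadData.P N X} →
                   IsMonadHom M N τ →
                   IsRelMonadHom (Δ*₀ M) (Δ*₀ N) (λ {X} → Δ*₁ {M} {N} τ {X})
Δ*-isRelMonadHom M N hom = record
  { τ-σ = λ f → τ-σ (φ f)
  ; τ-η = τ-η
  }
  where open IsMonadHom hom

-- Δ_* is a functor; it preserves identities and composites definitionally,
-- since Δ*₁ τ is τ with its (irrelevant) monotonicity proof.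
Δ*-isFunctor : Δ*-functor
Δ*-isFunctor =
    (λ P → Δ*-isRelMonad (Monad.dat P) (Monad.laws P))
  , (λ P Q t → Δ*-isRelMonadHom (Monad.dat P) (Monad.dat Q) (MonadHom.isHom t))
  , (λ P x → refl)
  , (λ P Q S t s x → refl)

U*-isMonad : (R : RelMonadData) → IsRelMonad R → IsMonad (U*₀ R)
U*-isMonad R laws = record
  { σ-η  = λ m → σ-η (φ⁻¹ m)
  ; σ-id = σ-id
  ; σ-σ  = λ m n → σ-σ (φ⁻¹ m) (φ⁻¹ n)
  }
  where open IsRelMonad laws

U*-isMonadHom : (R Q : RelMonadData)
                {τ : ∀ {X} → Mono (RelMonadData.R R X) (RelMonadData.R Q X)} →
                IsRelMonadHom R Q τ →
                IsMonadHom (U*₀ R) (U*₀ Q) (λ {X} → U*₁ {R} {Q} τ {X})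
U*-isMonadHom R Q hom = record
  { τ-σ = λ m → τ-σ (φ⁻¹ m)
  ; τ-η = τ-η
  }
  where open IsRelMonadHom hom

U*-isFunctor : U*-functor
U*-isFunctor =
    (λ R → U*-isMonad (RelMonad.dat R) (RelMonad.laws R))
  , (λ R Q t → U*-isMonadHom (RelMonad.dat R) (RelMonad.dat Q) (RelMonadHom.isHom t))
  , (λ R x → refl)
  , (λ R Q S t s x → refl)

transpose : (M : MonadData) (N : RelMonadData) →
            RelMonadHom (Δ*₀ M) N → MonadHom M (U*₀ N)
transpose M N t = record
  { τ     = φ τ
  ; isHom = record { τ-σ = λ m → τ-σ (φ⁻¹ m) ; τ-η = τ-η }
  }
  where open RelMonadHom t
        open IsRelMonadHom isHom

untranspose : (M : MonadData) (N : RelMonadData) →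
              MonadHom M (U*₀ N) → RelMonadHom (Δ*₀ M) N
untranspose M N m = record
  { τ     = φ⁻¹ τ
  ; isHom = record { τ-σ = λ f → τ-σ (φ f) ; τ-η = τ-η }
  }
  where open MonadHom m
        open IsMonadHom isHom

transpose-natural :
  (M' M : MonadData) (N N' : RelMonadData)
  (α : MonadHom M' M) (β : RelMonadHom N N')
  (t : RelMonadHom (Δ*₀ M) N) (t' : RelMonadHom (Δ*₀ M') N') →
  (∀ {X} → RelMonadHom.τ t' {X}
             ≐M (RelMonadHom.τ β ∘M (RelMonadHom.τ t ∘M Δ*₁ {M'} {M} (MonadHom.τ α)))) →
  ∀ {X} → MonadHom.τ (transpose M' N' t') {X}
            ≐ (λ x → U*₁ {N} {N'} (RelMonadHom.τ β)
                       (MonadHom.τ (transpose M N t) (MonadHom.τ α x)))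
transpose-natural M' M N N' α β t t' t'≐βtα = t'≐βtα

Δ*-leftAdjoint : Δ*⊣U*
Δ*-leftAdjoint =
    (λ P R → transpose (Monad.dat P) (RelMonad.dat R))
  , (λ P R → untranspose (Monad.dat P) (RelMonad.dat R))
  , (λ P R t {X} → φ⁻¹-φ (RelMonadHom.τ t {X}))
  , (λ P R m {X} → φ-φ⁻¹ {A = RelMonadData.R (RelMonad.dat R) X} (MonadHom.τ m))
  , (λ P' P R R' α β → transpose-natural (Monad.dat P') (Monad.dat P)
                                          (RelMonad.dat R) (RelMonad.dat R') α β)

mainTheorem2 : Δ*-functor × U*-functor × Δ*⊣U*
mainTheorem2 = Δ*-isFunctor , U*-isFunctor , Δ*-leftAdjoint
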